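{- Every proposition (of the language of $\mathrm{HA}_N$) provable in $\mathrm{HA}_N$ is provable in $\mathrm{HA}_{Class}$.
   Context: All theories are in intuitionistic (many-sorted) predicate logic. $\mathrm{HA}_N$ is the one-sorted theory over the language $0, S, +, \times, =, Pred, Null, N$ ($Null$, $N$ unary predicates) whose axioms are: the axioms of equality for all these symbols; the relativized induction scheme $(0/x)P \Rightarrow \forall y~(N(y) \Rightarrow (y/x)P \Rightarrow (S(y)/x)P) \Rightarrow \forall n~(N(n) \Rightarrow (n/x)P)$ for every proposition $P$ of this language; $N(0)$, $\forall x~(N(x)\Rightarrow N(S(x)))$, $Pred(0)=0$, $\forall x~(Pred(S(x))=x)$, $Null(0)$, $\forall x~\neg Null(S(x))$, $\forall y~(0+y=y)$, $\forall x\forall y~(S(x)+y=S(x+y))$, $\forall y~(0\times y=0)$, $\forall x\forall y~(S(x)\times y=x\times y+y)$. $\mathrm{HA}_{Class}$ is the two-sorted theory with sorts $\iota$ (numbers) and $\kappa$ (classes). Its language has constant $0:\iota$, function symbols $S, Pred$ of rank $\iota\to\iota$, $+,\times$ of rank $\iota,\iota\to\iota$, predicate symbols $=$ on $\iota,\iota$, $Null$ and $N$ on $\iota$, $\in$ on $\iota,\kappa$, and, for each proposition $P$ of the language $0,S,Pred,+,\times,=,Null,N$ whose free variables are among the $\iota$-variables $x,y_1,\dots,y_n$, a function symbol $f_{x,y_1,\dots,y_n,P}$ of rank $\iota,\dots,\iota\to\kappa$ ($n$ arguments). Its axioms (there are no separate equality axioms) are: $\forall y\forall z~(y=z\Leftrightarrow\forall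 p~(y\in p\Rightarrow z\in p))$; $\forall n~(N(n)\Leftrightarrow\forall p~(0\in p\Rightarrow\forall y~(N(y)\Rightarrow y\in p\Rightarrow S(y)\in p)\Rightarrow n\in p))$; for each such $P$, $\forall x\forall y_1\dots\forall y_n~(x\in f_{x,y_1,\dots,y_n,P}(y_1,\dots,y_n)\Leftrightarrow P)$; $Pred(0)=0$, $\forall x~(Pred(S(x))=x)$, $Null(0)$, $\forall x~\neg Null(S(x))$, $\forall y~(0+y=y)$, $\forall x\forall y~(S(x)+y=S(x+y))$, $\forall y~(0\times y=0)$, $\forall x\forall y~(S(x)\times y=x\times y+y)$. Here $p$ ranges over sort $\kappa$ and the other variables over sort $\iota$. -}

module Defs where

open import Data.List using (List; []; _∷_; map; replicate)
open import Data.List.Membership.Propositional using () renaming (_∈_ to _∈ᴸ_)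
open import Data.Unit using (⊤; tt)
open import Data.Nat using (ℕ; suc)

record Signature : Set₁ where
  field
    Sort : Set
    Fun  : List Sort → Sort → Set
    Rel  : List Sort → Set

module FOL (Sg : Signature) where
  open Signature Sg public

  Ctx : Set
  Ctx = List Sort

  data _∋_ : Ctx → Sort → Set where
    here  : ∀ {Γ s} → (s ∷ Γ) ∋ s
    there : ∀ {Γ s t} → Γ ∋ s → (t ∷ Γ) ∋ s

  mutual
    data Tm (Γ : Ctx) : Sort → Set where
      var : ∀ {s} → Γ ∋ s → Tm Γ s
      app : ∀ {ss s} → Fun ss s → Args Γ ss → Tm Γ s

    data Args (Γ : Ctx) : List Sort → Set where
      []  : Args Γ []
      _∷_ : ∀ {s ss} → Tm Γ s → Args Γ ss → Args Γ (s ∷ ss)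

  infixr 4 _⇔ᶠ_
  infixr 5 _⇒ᶠ_
  infixr 6 _∨ᶠ_
  infixr 7 _∧ᶠ_

  data Fm (Γ : Ctx) : Set where
    atom : ∀ {ss} → Rel ss → Args Γ ss → Fm Γ
    ⊤ᶠ ⊥ᶠ : Fm Γ
    _∧ᶠ_ _∨ᶠ_ _⇒ᶠ_ : Fm Γ → Fm Γ → Fm Γ
    ∀ᶠ ∃ᶠ : (s : Sort) → Fm (s ∷ Γ) → Fm Γ

  _⇔ᶠ_ : ∀ {Γ} → Fm Γ → Fm Γ → Fm Γ
  A ⇔ᶠ B = (A ⇒ᶠ B) ∧ᶠ (B ⇒ᶠ A)

  ¬ᶠ : ∀ {Γ} → Fm Γ → Fm Γ
  ¬ᶠ A = A ⇒ᶠ ⊥ᶠ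

  Ren : Ctx → Ctx → Set
  Ren Γ Δ = ∀ {s} → Γ ∋ s → Δ ∋ s

  liftR : ∀ {Γ Δ t} → Ren Γ Δ → Ren (t ∷ Γ) (t ∷ Δ)
  liftR ρ here      = here
  liftR ρ (there x) = there (ρ x)

  mutual
    renT : ∀ {Γ Δ s} → Ren Γ Δ → Tm Γ s → Tm Δ s
    renT ρ (var x)    = var (ρ x)
    renT ρ (app f as) = app f (renA ρ as)

    renA : ∀ {Γ Δ ss} → Ren Γ Δ → Args Γ ss → Args Δ ss
    renA ρ []       = []
    renA ρ (t ∷ as) = renT ρ t ∷ renA ρ as

  renF : ∀ {Γ Δ} → Ren Γ Δ → Fm Γ → Fm Δ
  renF ρ (atom r as) = atom r (renA ρ as)
  renF ρ ⊤ᶠ          = ⊤ᶠ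
  renF ρ ⊥ᶠ          = ⊥ᶠ
  renF ρ (A ∧ᶠ B)    = renF ρ A ∧ᶠ renF ρ B
  renF ρ (A ∨ᶠ B)    = renF ρ A ∨ᶠ renF ρ B
  renF ρ (A ⇒ᶠ B)    = renF ρ A ⇒ᶠ renF ρ B
  renF ρ (∀ᶠ s A)    = ∀ᶠ s (renF (liftR ρ) A)
  renF ρ (∃ᶠ s A)    = ∃ᶠ s (renF (liftR ρ) A)

  Sub : Ctx → Ctx → Set
  Sub Γ Δ = ∀ {s} → Γ ∋ s → Tm Δ s

  liftS : ∀ {Γ Δ t} → Sub Γ Δ → Sub (t ∷ Γ) (t ∷ Δ)
  liftS σ here      = var here
  liftS σ (there x) = renT there (σ x)

  mutual
    subT : ∀ {Γ Δ s} → Sub Γ Δ → Tm Γ s → Tm Δ s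
    subT σ (var x)    = σ x
    subT σ (app f as) = app f (subA σ as)

    subA : ∀ {Γ Δ ss} → Sub Γ Δ → Args Γ ss → Args Δ ss
    subA σ []       = []
    subA σ (t ∷ as) = subT σ t ∷ subA σ as

  subF : ∀ {Γ Δ} → Sub Γ Δ → Fm Γ → Fm Δ
  subF σ (atom r as) = atom r (subA σ as)
  subF σ ⊤ᶠ          = ⊤ᶠ
  subF σ ⊥ᶠ          = ⊥ᶠ
  subF σ (A ∧ᶠ B)    = subF σ A ∧ᶠ subF σ B
  subF σ (A ∨ᶠ B)    = subF σ A ∨ᶠ subF σ B
  subF σ (A ⇒ᶠ B)    = subF σ A ⇒ᶠ subF σ B
  subF σ (∀ᶠ s A)    = ∀ᶠ s (subF (liftS σ) A)
  subF σ (∃ᶠ s A)    = ∃ᶠ s (subF (liftS σ) A)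

  sub0 : ∀ {Γ s} → Tm Γ s → Sub (s ∷ Γ) Γ
  sub0 t here      = t
  sub0 t (there x) = var x

  _[_]₀ : ∀ {Γ s} → Fm (s ∷ Γ) → Tm Γ s → Fm Γ
  A [ t ]₀ = subF (sub0 t) A

  wkF : ∀ {Γ s} → Fm Γ → Fm (s ∷ Γ)
  wkF = renF there

  emptyRen : ∀ {Γ} → Ren [] Γ
  emptyRen ()

  idArgs : (Δ : Ctx) → Args Δ Δ
  idArgs []      = []
  idArgs (s ∷ Δ) = var here ∷ renA there (idArgs Δ)

  closeAll : (Γ : Ctx) → Fm Γ → Fm []
  closeAll []      A = A
  closeAll (s ∷ Γ) A = closeAll Γ (∀ᶠ s A)

  Theory : Set₁
  Theory = Fm [] → Set

  data Pf (T : Theory) : (Γ : Ctx) → List (Fm Γ) → Fm Γ → Set where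
    ax   : ∀ {Γ H A} → T A → Pf T Γ H (renF emptyRen A)
    hyp  : ∀ {Γ H A} → A ∈ᴸ H → Pf T Γ H A
    ⊤I   : ∀ {Γ H} → Pf T Γ H ⊤ᶠ
    ⊥E   : ∀ {Γ H A} → Pf T Γ H ⊥ᶠ → Pf T Γ H A
    ∧I   : ∀ {Γ H A B} → Pf T Γ H A → Pf T Γ H B → Pf T Γ H (A ∧ᶠ B)
    ∧E₁  : ∀ {Γ H A B} → Pf T Γ H (A ∧ᶠ B) → Pf T Γ H A
    ∧E₂  : ∀ {Γ H A B} → Pf T Γ H (A ∧ᶠ B) → Pf T Γ H B
    ∨I₁  : ∀ {Γ H A B} → Pf T Γ H A → Pf T Γ H (A ∨ᶠ B)
    ∨I₂  : ∀ {Γ H A B} → Pf T Γ H B → Pf T Γ H (A ∨ᶠ B)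
    ∨E   : ∀ {Γ H A B C} → Pf T Γ H (A ∨ᶠ B) → Pf T Γ (A ∷ H) C →
           Pf T Γ (B ∷ H) C → Pf T Γ H C
    ⇒I   : ∀ {Γ H A B} → Pf T Γ (A ∷ H) B → Pf T Γ H (A ⇒ᶠ B)
    ⇒E   : ∀ {Γ H A B} → Pf T Γ H (A ⇒ᶠ B) → Pf T Γ H A → Pf T Γ H B
    ∀I   : ∀ {Γ H s A} → Pf T (s ∷ Γ) (map wkF H) A → Pf T Γ H (∀ᶠ s A)
    ∀E   : ∀ {Γ H s A} → Pf T Γ H (∀ᶠ s A) → (t : Tm Γ s) → Pf T Γ H (A [ t ]₀)
    ∃I   : ∀ {Γ H s A} → (t : Tm Γ s) → Pf T Γ H (A [ t ]₀) → Pf T Γ H (∃ᶠ s A)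
    ∃E   : ∀ {Γ H s A C} → Pf T Γ H (∃ᶠ s A) →
           Pf T (s ∷ Γ) (A ∷ map wkF H) (wkF C) → Pf T Γ H C

  _⊢_ : ∀ {Γ} → Theory → Fm Γ → Set
  _⊢_ {Γ} T A = Pf T Γ [] A

data FunN : List ⊤ → ⊤ → Set where
  zeroN           : FunN [] tt
  succN predN     : FunN (tt ∷ []) tt
  plusN timesN    : FunN (tt ∷ tt ∷ []) tt

data RelN : List ⊤ → Set where
  eqN         : RelN (tt ∷ tt ∷ [])
  nullN natN  : RelN (tt ∷ [])

SigN : Signature
SigN = record { Sort = ⊤ ; Fun = FunN ; Rel = RelN }

module HAN where
  open FOL SigN public

  infixl 9 _+′_
  infixl 10 _×′_
  infix 8 _≐_

  𝟎 : ∀ {Γ} → Tm Γ tt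
  𝟎 = app zeroN []
  S′ P′ : ∀ {Γ} → Tm Γ tt → Tm Γ tt
  S′ t = app succN (t ∷ [])
  P′ t = app predN (t ∷ [])
  _+′_ _×′_ : ∀ {Γ} → Tm Γ tt → Tm Γ tt → Tm Γ tt
  a +′ b = app plusN (a ∷ b ∷ [])
  a ×′ b = app timesN (a ∷ b ∷ [])
  _≐_ : ∀ {Γ} → Tm Γ tt → Tm Γ tt → Fm Γ
  a ≐ b = atom eqN (a ∷ b ∷ [])
  Null′ Nat′ : ∀ {Γ} → Tm Γ tt → Fm Γ
  Null′ t = atom nullN (t ∷ [])
  Nat′ t  = atom natN (t ∷ [])
  ∀′ : ∀ {Γ} → Fm (tt ∷ Γ) → Fm Γ
  ∀′ = ∀ᶠ tt

  v0 : ∀ {Γ} → Tm (tt ∷ Γ) tt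
  v0 = var here
  v1 : ∀ {Γ} → Tm (tt ∷ tt ∷ Γ) tt
  v1 = var (there here)
  v2 : ∀ {Γ} → Tm (tt ∷ tt ∷ tt ∷ Γ) tt
  v2 = var (there (there here))
  v3 : ∀ {Γ} → Tm (tt ∷ tt ∷ tt ∷ tt ∷ Γ) tt
  v3 = var (there (there (there here)))

  -- Axioms for Pred, Null, +, × (common to HA_N and HA_Class).
  -- In ∀x∀y, x is the outer binder (v1) and y the inner one (v0).
  data Arith : Fm [] → Set where
    pred0  : Arith (P′ 𝟎 ≐ 𝟎)
    predS  : Arith (∀′ (P′ (S′ v0) ≐ v0))
    null0  : Arith (Null′ 𝟎)
    nullS  : Arith (∀′ (¬ᶠ (Null′ (S′ v0))))
    plus0  : Arith (∀′ (𝟎 +′ v0 ≐ v0))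
    plusS  : Arith (∀′ (∀′ (S′ v1 +′ v0 ≐ S′ (v1 +′ v0))))
    times0 : Arith (∀′ (𝟎 ×′ v0 ≐ 𝟎))
    timesS : Arith (∀′ (∀′ (S′ v1 ×′ v0 ≐ v1 ×′ v0 +′ v0)))

  -- (S(y)/x)P where x is the innermost variable, renamed to y
  substSucc : ∀ {Γ} → Sub (tt ∷ Γ) (tt ∷ Γ)
  substSucc here      = S′ (var here)
  substSucc (there x) = var (there x)

  -- the induction instance for P, whose variable x is the innermost one
  -- (the other free variables of P are parameters):
  -- (0/x)P ⇒ ∀y (N(y) ⇒ (y/x)P ⇒ (S(y)/x)P) ⇒ ∀n (N(n) ⇒ (n/x)P)
  Ind : ∀ {Γ} → Fm (tt ∷ Γ) → Fm Γ
  Ind P = (P [ 𝟎 ]₀)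
          ⇒ᶠ ∀′ (Nat′ v0 ⇒ᶠ P ⇒ᶠ subF substSucc P)
          ⇒ᶠ ∀′ (Nat′ v0 ⇒ᶠ P)

  data Axiom : Fm [] → Set where
    eq-refl  : Axiom (∀′ (v0 ≐ v0))
    eq-succ  : Axiom (∀′ (∀′ (v1 ≐ v0 ⇒ᶠ S′ v1 ≐ S′ v0)))
    eq-pred  : Axiom (∀′ (∀′ (v1 ≐ v0 ⇒ᶠ P′ v1 ≐ P′ v0)))
    eq-plus  : Axiom (∀′ (∀′ (∀′ (∀′
                 (v3 ≐ v2 ⇒ᶠ v1 ≐ v0 ⇒ᶠ v3 +′ v1 ≐ v2 +′ v0)))))
    eq-times : Axiom (∀′ (∀′ (∀′ (∀′
                 (v3 ≐ v2 ⇒ᶠ v1 ≐ v0 ⇒ᶠ v3 ×′ v1 ≐ v2 ×′ v0)))))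
    eq-eq    : Axiom (∀′ (∀′ (∀′ (∀′
                 (v3 ≐ v2 ⇒ᶠ v1 ≐ v0 ⇒ᶠ v3 ≐ v1 ⇒ᶠ v2 ≐ v0)))))
    eq-null  : Axiom (∀′ (∀′ (v1 ≐ v0 ⇒ᶠ Null′ v1 ⇒ᶠ Null′ v0)))
    eq-nat   : Axiom (∀′ (∀′ (v1 ≐ v0 ⇒ᶠ Nat′ v1 ⇒ᶠ Nat′ v0)))
    ind      : (Γ : Ctx) (P : Fm (tt ∷ Γ)) → Axiom (closeAll Γ (Ind P))
    nat0     : Axiom (Nat′ 𝟎)
    natS     : Axiom (∀′ (Nat′ v0 ⇒ᶠ Nat′ (S′ v0)))
    arith    : ∀ {A} → Arith A → Axiom A

data SortC : Set where
  ι κ : SortC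

toι : ⊤ → SortC
toι _ = ι

-- f_{x,y1..yn,P}: P is an HA_N proposition whose free variables are among
-- x (innermost de Bruijn variable, index 0) and y1..yn (indices 1..n)
data FunC : List SortC → SortC → Set where
  zeroC         : FunC [] ι
  succC predC   : FunC (ι ∷ []) ι
  plusC timesC  : FunC (ι ∷ ι ∷ []) ι
  comp          : (n : ℕ) → HAN.Fm (replicate (suc n) tt) →
                  FunC (map toι (replicate n tt)) κ

data RelC : List SortC → Set where
  eqC         : RelC (ι ∷ ι ∷ [])
  nullC natC  : RelC (ι ∷ [])
  memC        : RelC (ι ∷ κ ∷ [])

SigC : Signature
SigC = record { Sort = SortC ; Fun = FunC ; Rel = RelC }

module Embed where
  module N = FOL SigN
  module C = FOL SigC

  embV : ∀ {Γ s} → Γ N.∋ s → map toι Γ C.∋ toι s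
  embV N.here      = C.here
  embV (N.there x) = C.there (embV x)

  embFun : ∀ {ss s} → FunN ss s → FunC (map toι ss) (toι s)
  embFun zeroN  = zeroC
  embFun succN  = succC
  embFun predN  = predC
  embFun plusN  = plusC
  embFun timesN = timesC

  embRel : ∀ {ss} → RelN ss → RelC (map toι ss)
  embRel eqN   = eqC
  embRel nullN = nullC
  embRel natN  = natC

  mutual
    embT : ∀ {Γ s} → N.Tm Γ s → C.Tm (map toι Γ) (toι s)
    embT (N.var x)    = C.var (embV x)
    embT (N.app f as) = C.app (embFun f) (embA as)

    embA : ∀ {Γ ss} → N.Args Γ ss → C.Args (map toι Γ) (map toι ss)
    embA N.[]       = C.[]
    embA (t N.∷ as) = embT t C.∷ embA as

  embF : ∀ {Γ} → N.Fm Γ → C.Fm (map toι Γ)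
  embF (N.atom r as) = C.atom (embRel r) (embA as)
  embF N.⊤ᶠ          = C.⊤ᶠ
  embF N.⊥ᶠ          = C.⊥ᶠ
  embF (A N.∧ᶠ B)    = embF A C.∧ᶠ embF B
  embF (A N.∨ᶠ B)    = embF A C.∨ᶠ embF B
  embF (A N.⇒ᶠ B)    = embF A C.⇒ᶠ embF B
  embF (N.∀ᶠ s A)    = C.∀ᶠ (toι s) (embF A)
  embF (N.∃ᶠ s A)    = C.∃ᶠ (toι s) (embF A)

open Embed public using (embF)

module HAC where
  open FOL SigC public

  𝟎 : ∀ {Γ} → Tm Γ ι
  𝟎 = app zeroC []
  S′ : ∀ {Γ} → Tm Γ ι → Tm Γ ι
  S′ t = app succC (t ∷ [])
  _≐_ : ∀ {Γ} → Tm Γ ι → Tm Γ ι → Fm Γ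
  a ≐ b = atom eqC (a ∷ b ∷ [])
  Nat′ : ∀ {Γ} → Tm Γ ι → Fm Γ
  Nat′ t = atom natC (t ∷ [])
  _∈′_ : ∀ {Γ} → Tm Γ ι → Tm Γ κ → Fm Γ
  a ∈′ p = atom memC (a ∷ p ∷ [])

  infix 8 _≐_ _∈′_

  data Axiom : Fm [] → Set where
    eq-def  : Axiom (∀ᶠ ι (∀ᶠ ι
                (var (there here) ≐ var here
                 ⇔ᶠ ∀ᶠ κ (var (there (there here)) ∈′ var here
                          ⇒ᶠ var (there here) ∈′ var here))))
    nat-def : Axiom (∀ᶠ ι
                (Nat′ (var here)
                 ⇔ᶠ ∀ᶠ κ (𝟎 ∈′ var here
                          ⇒ᶠ ∀ᶠ ι (Nat′ (var here)
                                   ⇒ᶠ var here ∈′ var (there here)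
                                   ⇒ᶠ S′ (var here) ∈′ var (there here))
                          ⇒ᶠ var (there here) ∈′ var here)))
    -- ∀x ∀y1 .. ∀yn (x ∈ f_{x,y1..yn,P}(y1,..,yn) ⇔ P)
    -- (x is index 0 and yi is index i; closeAll binds x innermost)
    comp-ax : (n : ℕ) (P : HAN.Fm (replicate (suc n) tt)) →
              Axiom (closeAll (ι ∷ map toι (replicate n tt))
                (var here ∈′ app (comp n P)
                                 (renA there (idArgs (map toι (replicate n tt))))
                 ⇔ᶠ embF P))
    arith   : ∀ {A} → HAN.Arith A → Axiom (embF A)

module Submission where

-- An HA_N derivation is translated rule by rule, which needs only that the
-- embedding commutes with substitution, plus an HA_Class proof of each HA_N
-- axiom. The axioms of equality follow from the Leibniz definition of
-- equality applied to the class {x | P} of a suitable HA_N proposition P.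
-- For the induction instance of P, the class {x | P} contains 0 and is
-- closed under successor on N, so by the impredicative definition of N it
-- contains every natural number.

open import Defs
open import Data.List using (List; []; _∷_; map; replicate; length)
open import Data.List.Membership.Propositional using () renaming (_∈_ to _∈ᴸ_)
open import Data.List.Membership.Propositional.Properties using (∈-map⁺; ∈-map⁻)
open import Data.List.Relation.Binary.Subset.Propositional using (_⊆_)
open import Data.List.Relation.Unary.Any using () renaming (here to hereᴸ; there to thereᴸ)
open import Data.Nat using (ℕ)
open import Data.Product using (Σ-syntax; _,_; proj₂)
open import Data.Unit using (⊤; tt)
open import Relation.Binary.PropositionalEquality
  using (_≡_; refl; sym; trans; cong; cong₂; subst; subst₂)

module Metatheory (Sg : Signature) where
  open FOL Sg

  infix 4 _≗ʳ_ _≗ˢ_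

  _≗ʳ_ : ∀ {Γ Δ} → Ren Γ Δ → Ren Γ Δ → Set
  _≗ʳ_ {Γ} ρ ρ′ = ∀ {s} (x : Γ ∋ s) → ρ x ≡ ρ′ x

  _≗ˢ_ : ∀ {Γ Δ} → Sub Γ Δ → Sub Γ Δ → Set
  _≗ˢ_ {Γ} σ σ′ = ∀ {s} (x : Γ ∋ s) → σ x ≡ σ′ x

  wkT : ∀ {Γ s t} → Tm Γ s → Tm (t ∷ Γ) s
  wkT = renT there

  castPf : ∀ {T Γ H A B} → A ≡ B → Pf T Γ H A → Pf T Γ H B
  castPf {T} {Γ} {H} = subst (Pf T Γ H)

  hyp₀ : ∀ {T Γ H A} → Pf T Γ (A ∷ H) A
  hyp₀ = hyp (hereᴸ refl)

  hyp₁ : ∀ {T Γ H A B} → Pf T Γ (B ∷ A ∷ H) A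
  hyp₁ = hyp (thereᴸ (hereᴸ refl))

  hyp₂ : ∀ {T Γ H A B C} → Pf T Γ (C ∷ B ∷ A ∷ H) A
  hyp₂ = hyp (thereᴸ (thereᴸ (hereᴸ refl)))

  liftR-cong : ∀ {Γ Δ t} {ρ ρ′ : Ren Γ Δ} → ρ ≗ʳ ρ′ → liftR {t = t} ρ ≗ʳ liftR ρ′
  liftR-cong e here      = refl
  liftR-cong e (there x) = cong there (e x)

  mutual
    renT-cong : ∀ {Γ Δ s} {ρ ρ′ : Ren Γ Δ} → ρ ≗ʳ ρ′ → (t : Tm Γ s) → renT ρ t ≡ renT ρ′ t
    renT-cong e (var x)    = cong var (e x)
    renT-cong e (app f as) = cong (app f) (renA-cong e as)

    renA-cong : ∀ {Γ Δ ss} {ρ ρ′ : Ren Γ Δ} → ρ ≗ʳ ρ′ → (as : Args Γ ss) → renA ρ as ≡ renA ρ′ as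
    renA-cong e []       = refl
    renA-cong e (t ∷ as) = cong₂ _∷_ (renT-cong e t) (renA-cong e as)

  renF-cong : ∀ {Γ Δ} {ρ ρ′ : Ren Γ Δ} → ρ ≗ʳ ρ′ → (A : Fm Γ) → renF ρ A ≡ renF ρ′ A
  renF-cong e (atom r as) = cong (atom r) (renA-cong e as)
  renF-cong e ⊤ᶠ          = refl
  renF-cong e ⊥ᶠ          = refl
  renF-cong e (A ∧ᶠ B)    = cong₂ _∧ᶠ_ (renF-cong e A) (renF-cong e B)
  renF-cong e (A ∨ᶠ B)    = cong₂ _∨ᶠ_ (renF-cong e A) (renF-cong e B)
  renF-cong e (A ⇒ᶠ B)    = cong₂ _⇒ᶠ_ (renF-cong e A) (renF-cong e B)
  renF-cong e (∀ᶠ s A)    = cong (∀ᶠ s) (renF-cong (liftR-cong e) A)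
  renF-cong e (∃ᶠ s A)    = cong (∃ᶠ s) (renF-cong (liftR-cong e) A)

  liftR-liftR : ∀ {Γ Δ Θ t} (ρ : Ren Δ Θ) (ρ′ : Ren Γ Δ) →
                (λ x → liftR {t = t} ρ (liftR ρ′ x)) ≗ʳ liftR (λ x → ρ (ρ′ x))
  liftR-liftR ρ ρ′ here      = refl
  liftR-liftR ρ ρ′ (there x) = refl

  mutual
    renT-renT : ∀ {Γ Δ Θ s} (ρ : Ren Δ Θ) (ρ′ : Ren Γ Δ) (t : Tm Γ s) →
                renT ρ (renT ρ′ t) ≡ renT (λ x → ρ (ρ′ x)) t
    renT-renT ρ ρ′ (var x)    = refl
    renT-renT ρ ρ′ (app f as) = cong (app f) (renA-renA ρ ρ′ as)

    renA-renA : ∀ {Γ Δ Θ ss} (ρ : Ren Δ Θ) (ρ′ : Ren Γ Δ) (as : Args Γ ss) →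
                renA ρ (renA ρ′ as) ≡ renA (λ x → ρ (ρ′ x)) as
    renA-renA ρ ρ′ []       = refl
    renA-renA ρ ρ′ (t ∷ as) = cong₂ _∷_ (renT-renT ρ ρ′ t) (renA-renA ρ ρ′ as)

  renF-renF : ∀ {Γ Δ Θ} (ρ : Ren Δ Θ) (ρ′ : Ren Γ Δ) (A : Fm Γ) →
              renF ρ (renF ρ′ A) ≡ renF (λ x → ρ (ρ′ x)) A
  renF-renF ρ ρ′ (atom r as) = cong (atom r) (renA-renA ρ ρ′ as)
  renF-renF ρ ρ′ ⊤ᶠ          = refl
  renF-renF ρ ρ′ ⊥ᶠ          = refl
  renF-renF ρ ρ′ (A ∧ᶠ B)    = cong₂ _∧ᶠ_ (renF-renF ρ ρ′ A) (renF-renF ρ ρ′ B)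
  renF-renF ρ ρ′ (A ∨ᶠ B)    = cong₂ _∨ᶠ_ (renF-renF ρ ρ′ A) (renF-renF ρ ρ′ B)
  renF-renF ρ ρ′ (A ⇒ᶠ B)    = cong₂ _⇒ᶠ_ (renF-renF ρ ρ′ A) (renF-renF ρ ρ′ B)
  renF-renF ρ ρ′ (∀ᶠ s A)    =
    cong (∀ᶠ s) (trans (renF-renF (liftR ρ) (liftR ρ′) A) (renF-cong (liftR-liftR ρ ρ′) A))
  renF-renF ρ ρ′ (∃ᶠ s A)    =
    cong (∃ᶠ s) (trans (renF-renF (liftR ρ) (liftR ρ′) A) (renF-cong (liftR-liftR ρ ρ′) A))

  liftR-id : ∀ {Γ t} {ρ : Ren Γ Γ} → ρ ≗ʳ (λ x → x) → liftR {t = t} ρ ≗ʳ (λ x → x)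
  liftR-id e here      = refl
  liftR-id e (there x) = cong there (e x)

  mutual
    renT-id : ∀ {Γ s} {ρ : Ren Γ Γ} → ρ ≗ʳ (λ x → x) → (t : Tm Γ s) → renT ρ t ≡ t
    renT-id e (var x)    = cong var (e x)
    renT-id e (app f as) = cong (app f) (renA-id e as)

    renA-id : ∀ {Γ ss} {ρ : Ren Γ Γ} → ρ ≗ʳ (λ x → x) → (as : Args Γ ss) → renA ρ as ≡ as
    renA-id e []       = refl
    renA-id e (t ∷ as) = cong₂ _∷_ (renT-id e t) (renA-id e as)

  renF-id : ∀ {Γ} {ρ : Ren Γ Γ} → ρ ≗ʳ (λ x → x) → (A : Fm Γ) → renF ρ A ≡ A
  renF-id e (atom r as) = cong (atom r) (renA-id e as)
  renF-id e ⊤ᶠ          = refl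
  renF-id e ⊥ᶠ          = refl
  renF-id e (A ∧ᶠ B)    = cong₂ _∧ᶠ_ (renF-id e A) (renF-id e B)
  renF-id e (A ∨ᶠ B)    = cong₂ _∨ᶠ_ (renF-id e A) (renF-id e B)
  renF-id e (A ⇒ᶠ B)    = cong₂ _⇒ᶠ_ (renF-id e A) (renF-id e B)
  renF-id e (∀ᶠ s A)    = cong (∀ᶠ s) (renF-id (liftR-id e) A)
  renF-id e (∃ᶠ s A)    = cong (∃ᶠ s) (renF-id (liftR-id e) A)

  liftS-cong : ∀ {Γ Δ t} {σ σ′ : Sub Γ Δ} → σ ≗ˢ σ′ → liftS {t = t} σ ≗ˢ liftS σ′
  liftS-cong e here      = refl
  liftS-cong e (there x) = cong wkT (e x)

  mutual
    subT-cong : ∀ {Γ Δ s} {σ σ′ : Sub Γ Δ} → σ ≗ˢ σ′ → (t : Tm Γ s) → subT σ t ≡ subT σ′ t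
    subT-cong e (var x)    = e x
    subT-cong e (app f as) = cong (app f) (subA-cong e as)

    subA-cong : ∀ {Γ Δ ss} {σ σ′ : Sub Γ Δ} → σ ≗ˢ σ′ → (as : Args Γ ss) → subA σ as ≡ subA σ′ as
    subA-cong e []       = refl
    subA-cong e (t ∷ as) = cong₂ _∷_ (subT-cong e t) (subA-cong e as)

  subF-cong : ∀ {Γ Δ} {σ σ′ : Sub Γ Δ} → σ ≗ˢ σ′ → (A : Fm Γ) → subF σ A ≡ subF σ′ A
  subF-cong e (atom r as) = cong (atom r) (subA-cong e as)
  subF-cong e ⊤ᶠ          = refl
  subF-cong e ⊥ᶠ          = refl
  subF-cong e (A ∧ᶠ B)    = cong₂ _∧ᶠ_ (subF-cong e A) (subF-cong e B)
  subF-cong e (A ∨ᶠ B)    = cong₂ _∨ᶠ_ (subF-cong e A) (subF-cong e B)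
  subF-cong e (A ⇒ᶠ B)    = cong₂ _⇒ᶠ_ (subF-cong e A) (subF-cong e B)
  subF-cong e (∀ᶠ s A)    = cong (∀ᶠ s) (subF-cong (liftS-cong e) A)
  subF-cong e (∃ᶠ s A)    = cong (∃ᶠ s) (subF-cong (liftS-cong e) A)

  liftS-liftR : ∀ {Γ Δ Θ t} (σ : Sub Δ Θ) (ρ : Ren Γ Δ) →
                (λ x → liftS {t = t} σ (liftR ρ x)) ≗ˢ liftS (λ x → σ (ρ x))
  liftS-liftR σ ρ here      = refl
  liftS-liftR σ ρ (there x) = refl

  mutual
    subT-renT : ∀ {Γ Δ Θ s} (σ : Sub Δ Θ) (ρ : Ren Γ Δ) (t : Tm Γ s) →
                subT σ (renT ρ t) ≡ subT (λ x → σ (ρ x)) t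
    subT-renT σ ρ (var x)    = refl
    subT-renT σ ρ (app f as) = cong (app f) (subA-renA σ ρ as)

    subA-renA : ∀ {Γ Δ Θ ss} (σ : Sub Δ Θ) (ρ : Ren Γ Δ) (as : Args Γ ss) →
                subA σ (renA ρ as) ≡ subA (λ x → σ (ρ x)) as
    subA-renA σ ρ []       = refl
    subA-renA σ ρ (t ∷ as) = cong₂ _∷_ (subT-renT σ ρ t) (subA-renA σ ρ as)

  subF-renF : ∀ {Γ Δ Θ} (σ : Sub Δ Θ) (ρ : Ren Γ Δ) (A : Fm Γ) →
              subF σ (renF ρ A) ≡ subF (λ x → σ (ρ x)) A
  subF-renF σ ρ (atom r as) = cong (atom r) (subA-renA σ ρ as)
  subF-renF σ ρ ⊤ᶠ          = refl
  subF-renF σ ρ ⊥ᶠ          = refl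
  subF-renF σ ρ (A ∧ᶠ B)    = cong₂ _∧ᶠ_ (subF-renF σ ρ A) (subF-renF σ ρ B)
  subF-renF σ ρ (A ∨ᶠ B)    = cong₂ _∨ᶠ_ (subF-renF σ ρ A) (subF-renF σ ρ B)
  subF-renF σ ρ (A ⇒ᶠ B)    = cong₂ _⇒ᶠ_ (subF-renF σ ρ A) (subF-renF σ ρ B)
  subF-renF σ ρ (∀ᶠ s A)    =
    cong (∀ᶠ s) (trans (subF-renF (liftS σ) (liftR ρ) A) (subF-cong (liftS-liftR σ ρ) A))
  subF-renF σ ρ (∃ᶠ s A)    =
    cong (∃ᶠ s) (trans (subF-renF (liftS σ) (liftR ρ) A) (subF-cong (liftS-liftR σ ρ) A))

  mutual
    renT-subT : ∀ {Γ Δ Θ s} (ρ : Ren Δ Θ) (σ : Sub Γ Δ) (t : Tm Γ s) →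
                renT ρ (subT σ t) ≡ subT (λ x → renT ρ (σ x)) t
    renT-subT ρ σ (var x)    = refl
    renT-subT ρ σ (app f as) = cong (app f) (renA-subA ρ σ as)

    renA-subA : ∀ {Γ Δ Θ ss} (ρ : Ren Δ Θ) (σ : Sub Γ Δ) (as : Args Γ ss) →
                renA ρ (subA σ as) ≡ subA (λ x → renT ρ (σ x)) as
    renA-subA ρ σ []       = refl
    renA-subA ρ σ (t ∷ as) = cong₂ _∷_ (renT-subT ρ σ t) (renA-subA ρ σ as)

  liftR-liftS : ∀ {Γ Δ Θ t} (ρ : Ren Δ Θ) (σ : Sub Γ Δ) →
                (λ x → renT (liftR {t = t} ρ) (liftS σ x)) ≗ˢ liftS (λ x → renT ρ (σ x))
  liftR-liftS ρ σ here      = refl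
  liftR-liftS ρ σ (there x) = trans (renT-renT (liftR ρ) there (σ x)) (sym (renT-renT there ρ (σ x)))

  renF-subF : ∀ {Γ Δ Θ} (ρ : Ren Δ Θ) (σ : Sub Γ Δ) (A : Fm Γ) →
              renF ρ (subF σ A) ≡ subF (λ x → renT ρ (σ x)) A
  renF-subF ρ σ (atom r as) = cong (atom r) (renA-subA ρ σ as)
  renF-subF ρ σ ⊤ᶠ          = refl
  renF-subF ρ σ ⊥ᶠ          = refl
  renF-subF ρ σ (A ∧ᶠ B)    = cong₂ _∧ᶠ_ (renF-subF ρ σ A) (renF-subF ρ σ B)
  renF-subF ρ σ (A ∨ᶠ B)    = cong₂ _∨ᶠ_ (renF-subF ρ σ A) (renF-subF ρ σ B)
  renF-subF ρ σ (A ⇒ᶠ B)    = cong₂ _⇒ᶠ_ (renF-subF ρ σ A) (renF-subF ρ σ B)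
  renF-subF ρ σ (∀ᶠ s A)    =
    cong (∀ᶠ s) (trans (renF-subF (liftR ρ) (liftS σ) A) (subF-cong (liftR-liftS ρ σ) A))
  renF-subF ρ σ (∃ᶠ s A)    =
    cong (∃ᶠ s) (trans (renF-subF (liftR ρ) (liftS σ) A) (subF-cong (liftR-liftS ρ σ) A))

  liftS-id : ∀ {Γ t} {σ : Sub Γ Γ} → σ ≗ˢ var → liftS {t = t} σ ≗ˢ var
  liftS-id e here      = refl
  liftS-id e (there x) = cong wkT (e x)

  mutual
    subT-id : ∀ {Γ s} {σ : Sub Γ Γ} → σ ≗ˢ var → (t : Tm Γ s) → subT σ t ≡ t
    subT-id e (var x)    = e x
    subT-id e (app f as) = cong (app f) (subA-id e as)

    subA-id : ∀ {Γ ss} {σ : Sub Γ Γ} → σ ≗ˢ var → (as : Args Γ ss) → subA σ as ≡ as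
    subA-id e []       = refl
    subA-id e (t ∷ as) = cong₂ _∷_ (subT-id e t) (subA-id e as)

  subF-id : ∀ {Γ} {σ : Sub Γ Γ} → σ ≗ˢ var → (A : Fm Γ) → subF σ A ≡ A
  subF-id e (atom r as) = cong (atom r) (subA-id e as)
  subF-id e ⊤ᶠ          = refl
  subF-id e ⊥ᶠ          = refl
  subF-id e (A ∧ᶠ B)    = cong₂ _∧ᶠ_ (subF-id e A) (subF-id e B)
  subF-id e (A ∨ᶠ B)    = cong₂ _∨ᶠ_ (subF-id e A) (subF-id e B)
  subF-id e (A ⇒ᶠ B)    = cong₂ _⇒ᶠ_ (subF-id e A) (subF-id e B)
  subF-id e (∀ᶠ s A)    = cong (∀ᶠ s) (subF-id (liftS-id e) A)
  subF-id e (∃ᶠ s A)    = cong (∃ᶠ s) (subF-id (liftS-id e) A)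

  wkT-sub0 : ∀ {Γ s t} (u : Tm Γ t) (a : Tm Γ s) → subT (sub0 u) (wkT a) ≡ a
  wkT-sub0 u a = trans (subT-renT (sub0 u) there a) (subT-id (λ _ → refl) a)

  wkT-wkT : ∀ {Γ s t u} (a : Tm Γ s) →
            renT (liftR {t = t} (there {t = u})) (wkT a) ≡ wkT (wkT a)
  wkT-wkT a = trans (renT-renT (liftR there) there a) (sym (renT-renT there there a))

  subT-liftS-wkT : ∀ {Γ Δ s t} (σ : Sub Γ Δ) (a : Tm Γ s) →
                   subT (liftS {t = t} σ) (wkT a) ≡ wkT (subT σ a)
  subT-liftS-wkT σ a = trans (subT-renT (liftS σ) there a) (sym (renT-subT there σ a))

  renF-wkF : ∀ {Γ Δ s} (ρ : Ren Γ Δ) (A : Fm Γ) →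
             renF (liftR {t = s} ρ) (wkF A) ≡ wkF (renF ρ A)
  renF-wkF ρ A = trans (renF-renF (liftR ρ) there A) (sym (renF-renF there ρ A))

  renF-sub0 : ∀ {Γ Δ s} (ρ : Ren Γ Δ) (t : Tm Γ s) (A : Fm (s ∷ Γ)) →
              renF ρ (A [ t ]₀) ≡ renF (liftR ρ) A [ renT ρ t ]₀
  renF-sub0 ρ t A =
    trans (renF-subF ρ (sub0 t) A)
      (trans (subF-cong (λ { here → refl ; (there x) → refl }) A)
        (sym (subF-renF (sub0 (renT ρ t)) (liftR ρ) A)))

  liftR-wkF-sub0-var : ∀ {Γ s} (A : Fm (s ∷ Γ)) → renF (liftR there) A [ var here ]₀ ≡ A
  liftR-wkF-sub0-var A =
    trans (subF-renF (sub0 (var here)) (liftR there) A)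
      (subF-id (λ { here → refl ; (there x) → refl }) A)

  RenHyps : ∀ {Γ Δ} → Ren Γ Δ → List (Fm Γ) → List (Fm Δ) → Set
  RenHyps ρ H H′ = ∀ {A} → A ∈ᴸ H → renF ρ A ∈ᴸ H′

  RenHyps-∷ : ∀ {Γ Δ} {ρ : Ren Γ Δ} {H H′ A} → RenHyps ρ H H′ → RenHyps ρ (A ∷ H) (renF ρ A ∷ H′)
  RenHyps-∷ i (hereᴸ refl) = hereᴸ refl
  RenHyps-∷ i (thereᴸ m)   = thereᴸ (i m)

  RenHyps-wk : ∀ {Γ Δ s} {ρ : Ren Γ Δ} {H H′} → RenHyps ρ H H′ →
               RenHyps (liftR {t = s} ρ) (map wkF H) (map wkF H′)
  RenHyps-wk {ρ = ρ} {H′ = H′} i m with ∈-map⁻ wkF m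
  ... | A , m′ , refl = subst (_∈ᴸ map wkF H′) (sym (renF-wkF ρ A)) (∈-map⁺ wkF (i m′))

  renPf : ∀ {T Γ Δ H H′ A} (ρ : Ren Γ Δ) → RenHyps ρ H H′ → Pf T Γ H A → Pf T Δ H′ (renF ρ A)
  renPf ρ i (ax {A = A} a)     =
    castPf (sym (trans (renF-renF ρ emptyRen A) (renF-cong (λ ()) A))) (ax a)
  renPf ρ i (hyp m)            = hyp (i m)
  renPf ρ i ⊤I                 = ⊤I
  renPf ρ i (⊥E p)             = ⊥E (renPf ρ i p)
  renPf ρ i (∧I p q)           = ∧I (renPf ρ i p) (renPf ρ i q)
  renPf ρ i (∧E₁ p)            = ∧E₁ (renPf ρ i p)
  renPf ρ i (∧E₂ p)            = ∧E₂ (renPf ρ i p)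
  renPf ρ i (∨I₁ p)            = ∨I₁ (renPf ρ i p)
  renPf ρ i (∨I₂ p)            = ∨I₂ (renPf ρ i p)
  renPf ρ i (∨E p q r)         = ∨E (renPf ρ i p) (renPf ρ (RenHyps-∷ i) q) (renPf ρ (RenHyps-∷ i) r)
  renPf ρ i (⇒I p)             = ⇒I (renPf ρ (RenHyps-∷ i) p)
  renPf ρ i (⇒E p q)           = ⇒E (renPf ρ i p) (renPf ρ i q)
  renPf ρ i (∀I p)             = ∀I (renPf (liftR ρ) (RenHyps-wk i) p)
  renPf ρ i (∀E {A = A} p t)   = castPf (sym (renF-sub0 ρ t A)) (∀E (renPf ρ i p) (renT ρ t))
  renPf ρ i (∃I {A = A} t p)   = ∃I (renT ρ t) (castPf (renF-sub0 ρ t A) (renPf ρ i p))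
  renPf ρ i (∃E {C = C} p q)   =
    ∃E (renPf ρ i p) (castPf (renF-wkF ρ C) (renPf (liftR ρ) (RenHyps-∷ (RenHyps-wk i)) q))

  weakenHyps : ∀ {T Γ H H′ A} → H ⊆ H′ → Pf T Γ H A → Pf T Γ H′ A
  weakenHyps {H′ = H′} {A} H⊆H′ p =
    castPf (renF-id (λ _ → refl) A)
      (renPf (λ x → x) (λ {B} m → subst (_∈ᴸ H′) (sym (renF-id (λ _ → refl) B)) (H⊆H′ m)) p)

  wkPf : ∀ {T Γ s H A} → Pf T Γ H A → Pf T (s ∷ Γ) (map wkF H) (wkF A)
  wkPf = renPf there (∈-map⁺ wkF)

  ∀E-var : ∀ {T Γ s H A} → Pf T Γ H (∀ᶠ s A) → Pf T (s ∷ Γ) (map wkF H) A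
  ∀E-var {A = A} p = castPf (liftR-wkF-sub0-var A) (∀E (wkPf p) (var here))

  ∀-⇒-trans : ∀ {T Γ s H} {A B C : Fm (s ∷ Γ)} →
              Pf T Γ H (∀ᶠ s (A ⇒ᶠ B)) → Pf T Γ H (∀ᶠ s (B ⇒ᶠ C)) → Pf T Γ H (∀ᶠ s (A ⇒ᶠ C))
  ∀-⇒-trans p q = ∀I (⇒I (⇒E (weakenHyps thereᴸ (∀E-var q)) (⇒E (weakenHyps thereᴸ (∀E-var p)) hyp₀)))

  closeAll-intro : ∀ {T} (Γ : Ctx) {A : Fm Γ} → Pf T Γ [] A → Pf T [] [] (closeAll Γ A)
  closeAll-intro []      p = p
  closeAll-intro (s ∷ Γ) p = closeAll-intro Γ (∀I p)

  closeAll-elim : ∀ {T} (Γ : Ctx) {A : Fm Γ} → Pf T [] [] (closeAll Γ A) → Pf T Γ [] A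
  closeAll-elim []      p = p
  closeAll-elim (s ∷ Γ) p = ∀E-var (closeAll-elim Γ p)

  axiom : ∀ {T H A} → T A → Pf T [] H A
  axiom {A = A} a = castPf (renF-id (λ ()) A) (ax a)

module N = HAN
open HAC
open Metatheory SigC
open Embed using (embV; embT; embA; embFun; embRel)

embRen : ∀ {Γ Δ} → N.Ren Γ Δ → Ren (map toι Γ) (map toι Δ)
embRen {_ ∷ Γ} ρ here      = embV (ρ N.here)
embRen {_ ∷ Γ} ρ (there y) = embRen (λ x → ρ (N.there x)) y

embSub : ∀ {Γ Δ} → N.Sub Γ Δ → Sub (map toι Γ) (map toι Δ)
embSub {_ ∷ Γ} σ here      = embT (σ N.here)
embSub {_ ∷ Γ} σ (there y) = embSub (λ x → σ (N.there x)) y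

embRen-embV : ∀ {Γ Δ s} (ρ : N.Ren Γ Δ) (x : Γ N.∋ s) → embRen ρ (embV x) ≡ embV (ρ x)
embRen-embV ρ N.here      = refl
embRen-embV ρ (N.there x) = embRen-embV (λ y → ρ (N.there y)) x

embSub-embV : ∀ {Γ Δ s} (σ : N.Sub Γ Δ) (x : Γ N.∋ s) → embSub σ (embV x) ≡ embT (σ x)
embSub-embV σ N.here      = refl
embSub-embV σ (N.there x) = embSub-embV (λ y → σ (N.there y)) x

embRen-there : ∀ {Γ Δ t} (ρ : N.Ren Γ Δ) →
               embRen (λ x → N.there {t = t} (ρ x)) ≗ʳ (λ y → there (embRen ρ y))
embRen-there {_ ∷ Γ} ρ here      = refl
embRen-there {_ ∷ Γ} ρ (there y) = embRen-there (λ x → ρ (N.there x)) y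

embRen-id : ∀ {Γ} → embRen {Γ} (λ x → x) ≗ʳ (λ y → y)
embRen-id {_ ∷ Γ} here      = refl
embRen-id {_ ∷ Γ} (there y) = trans (embRen-there (λ x → x) y) (cong there (embRen-id y))

embRen-wk : ∀ {Γ t} → embRen {Γ} (N.there {t = t}) ≗ʳ there
embRen-wk y = trans (embRen-there (λ x → x) y) (cong there (embRen-id y))

embSub-var : ∀ {Γ Δ} (ρ : N.Ren Γ Δ) → embSub (λ x → N.var (ρ x)) ≗ˢ (λ y → var (embRen ρ y))
embSub-var {_ ∷ Γ} ρ here      = refl
embSub-var {_ ∷ Γ} ρ (there y) = embSub-var (λ x → ρ (N.there x)) y

mutual
  embT-renT : ∀ {Γ Δ s} (ρ : N.Ren Γ Δ) (t : N.Tm Γ s) → embT (N.renT ρ t) ≡ renT (embRen ρ) (embT t)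
  embT-renT ρ (N.var x)    = cong var (sym (embRen-embV ρ x))
  embT-renT ρ (N.app f as) = cong (app (embFun f)) (embA-renA ρ as)

  embA-renA : ∀ {Γ Δ ss} (ρ : N.Ren Γ Δ) (as : N.Args Γ ss) → embA (N.renA ρ as) ≡ renA (embRen ρ) (embA as)
  embA-renA ρ N.[]       = refl
  embA-renA ρ (t N.∷ as) = cong₂ _∷_ (embT-renT ρ t) (embA-renA ρ as)

embRen-liftR : ∀ {Γ Δ t} (ρ : N.Ren Γ Δ) → embRen (N.liftR {t = t} ρ) ≗ʳ liftR (embRen ρ)
embRen-liftR ρ here      = refl
embRen-liftR ρ (there y) = embRen-there ρ y

embF-renF : ∀ {Γ Δ} (ρ : N.Ren Γ Δ) (A : N.Fm Γ) → embF (N.renF ρ A) ≡ renF (embRen ρ) (embF A)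
embF-renF ρ (N.atom r as) = cong (atom (embRel r)) (embA-renA ρ as)
embF-renF ρ N.⊤ᶠ          = refl
embF-renF ρ N.⊥ᶠ          = refl
embF-renF ρ (A N.∧ᶠ B)    = cong₂ _∧ᶠ_ (embF-renF ρ A) (embF-renF ρ B)
embF-renF ρ (A N.∨ᶠ B)    = cong₂ _∨ᶠ_ (embF-renF ρ A) (embF-renF ρ B)
embF-renF ρ (A N.⇒ᶠ B)    = cong₂ _⇒ᶠ_ (embF-renF ρ A) (embF-renF ρ B)
embF-renF ρ (N.∀ᶠ s A)    =
  cong (∀ᶠ ι) (trans (embF-renF (N.liftR ρ) A) (renF-cong (embRen-liftR ρ) (embF A)))
embF-renF ρ (N.∃ᶠ s A)    =
  cong (∃ᶠ ι) (trans (embF-renF (N.liftR ρ) A) (renF-cong (embRen-liftR ρ) (embF A)))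

embT-wkT : ∀ {Γ s t} (a : N.Tm Γ s) → embT (N.renT (N.there {t = t}) a) ≡ wkT (embT a)
embT-wkT a = trans (embT-renT N.there a) (renT-cong embRen-wk (embT a))

embF-wkF : ∀ {Γ t} (A : N.Fm Γ) → embF (N.wkF {s = t} A) ≡ wkF (embF A)
embF-wkF A = trans (embF-renF N.there A) (renF-cong embRen-wk (embF A))

map-embF-wkF : ∀ {Γ t} (H : List (N.Fm Γ)) → map embF (map (N.wkF {s = t}) H) ≡ map wkF (map embF H)
map-embF-wkF []      = refl
map-embF-wkF (A ∷ H) = cong₂ _∷_ (embF-wkF A) (map-embF-wkF H)

embSub-wk : ∀ {Γ Δ t} (σ : N.Sub Γ Δ) →
            embSub (λ x → N.renT (N.there {t = t}) (σ x)) ≗ˢ (λ y → wkT (embSub σ y))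
embSub-wk {_ ∷ Γ} σ here      = embT-wkT (σ N.here)
embSub-wk {_ ∷ Γ} σ (there y) = embSub-wk (λ x → σ (N.there x)) y

mutual
  embT-subT : ∀ {Γ Δ s} (σ : N.Sub Γ Δ) (t : N.Tm Γ s) → embT (N.subT σ t) ≡ subT (embSub σ) (embT t)
  embT-subT σ (N.var x)    = sym (embSub-embV σ x)
  embT-subT σ (N.app f as) = cong (app (embFun f)) (embA-subA σ as)

  embA-subA : ∀ {Γ Δ ss} (σ : N.Sub Γ Δ) (as : N.Args Γ ss) → embA (N.subA σ as) ≡ subA (embSub σ) (embA as)
  embA-subA σ N.[]       = refl
  embA-subA σ (t N.∷ as) = cong₂ _∷_ (embT-subT σ t) (embA-subA σ as)

embSub-liftS : ∀ {Γ Δ t} (σ : N.Sub Γ Δ) → embSub (N.liftS {t = t} σ) ≗ˢ liftS (embSub σ)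
embSub-liftS σ here      = refl
embSub-liftS σ (there y) = embSub-wk σ y

embF-subF : ∀ {Γ Δ} (σ : N.Sub Γ Δ) (A : N.Fm Γ) → embF (N.subF σ A) ≡ subF (embSub σ) (embF A)
embF-subF σ (N.atom r as) = cong (atom (embRel r)) (embA-subA σ as)
embF-subF σ N.⊤ᶠ          = refl
embF-subF σ N.⊥ᶠ          = refl
embF-subF σ (A N.∧ᶠ B)    = cong₂ _∧ᶠ_ (embF-subF σ A) (embF-subF σ B)
embF-subF σ (A N.∨ᶠ B)    = cong₂ _∨ᶠ_ (embF-subF σ A) (embF-subF σ B)
embF-subF σ (A N.⇒ᶠ B)    = cong₂ _⇒ᶠ_ (embF-subF σ A) (embF-subF σ B)
embF-subF σ (N.∀ᶠ s A)    =
  cong (∀ᶠ ι) (trans (embF-subF (N.liftS σ) A) (subF-cong (embSub-liftS σ) (embF A)))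
embF-subF σ (N.∃ᶠ s A)    =
  cong (∃ᶠ ι) (trans (embF-subF (N.liftS σ) A) (subF-cong (embSub-liftS σ) (embF A)))

embF-sub0 : ∀ {Γ} (A : N.Fm (tt ∷ Γ)) (t : N.Tm Γ tt) → embF (A N.[ t ]₀) ≡ embF A [ embT t ]₀
embF-sub0 A t = trans (embF-subF (N.sub0 t) A) (subF-cong embSub-sub0 (embF A))
  where
  embSub-sub0 : embSub (N.sub0 t) ≗ˢ sub0 (embT t)
  embSub-sub0 here      = refl
  embSub-sub0 (there y) = trans (embSub-var (λ x → x) y) (cong var (embRen-id y))

embF-substSucc : ∀ {Γ} (A : N.Fm (tt ∷ Γ)) →
                 embF (N.subF N.substSucc A) ≡ renF (liftR there) (embF A) [ S′ (var here) ]₀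
embF-substSucc A =
  trans (embF-subF N.substSucc A)
    (trans (subF-cong embSub-substSucc (embF A))
      (sym (subF-renF (sub0 (S′ (var here))) (liftR there) (embF A))))
  where
  embSub-substSucc : embSub N.substSucc ≗ˢ (λ y → sub0 (S′ (var here)) (liftR there y))
  embSub-substSucc here      = refl
  embSub-substSucc (there y) = trans (embSub-var N.there y) (cong var (embRen-wk y))

embF-closeAll : (Γ : List ⊤) (A : N.Fm Γ) → embF (N.closeAll Γ A) ≡ closeAll (map toι Γ) (embF A)
embF-closeAll []      A = refl
embF-closeAll (t ∷ Γ) A = embF-closeAll Γ (N.∀ᶠ t A)

infix 3 _⊢ᶜ_

_⊢ᶜ_ : ∀ {Δ} → List (Fm Δ) → Fm Δ → Set
_⊢ᶜ_ {Δ} H A = Pf Axiom Δ H A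

v₀ : ∀ {Γ s} → Tm (s ∷ Γ) s
v₀ = var here

v₁ : ∀ {Γ s t} → Tm (t ∷ s ∷ Γ) s
v₁ = var (there here)

≐-unfold : ∀ {Δ} {H : List (Fm Δ)} (a b : Tm Δ ι) →
           H ⊢ᶜ a ≐ b ⇔ᶠ ∀ᶠ κ (wkT a ∈′ v₀ ⇒ᶠ wkT b ∈′ v₀)
≐-unfold a b =
  subst₂ (λ u w → _ ⊢ᶜ u ≐ b ⇔ᶠ ∀ᶠ κ (w ∈′ v₀ ⇒ᶠ wkT b ∈′ v₀))
    (wkT-sub0 b a) (trans (subT-liftS-wkT (sub0 b) (wkT a)) (cong wkT (wkT-sub0 b a)))
    (∀E (∀E (ax eq-def) a) b)

≐-refl : ∀ {Δ} {H : List (Fm Δ)} (t : Tm Δ ι) → H ⊢ᶜ t ≐ t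
≐-refl t = ⇒E (∧E₂ (≐-unfold t t)) (∀I (⇒I hyp₀))

≐-elim : ∀ {Δ} {H : List (Fm Δ)} {a b : Tm Δ ι} → H ⊢ᶜ a ≐ b → (c : Tm Δ κ) → H ⊢ᶜ a ∈′ c ⇒ᶠ b ∈′ c
≐-elim {a = a} {b} e c =
  subst₂ (λ u w → _ ⊢ᶜ u ∈′ c ⇒ᶠ w ∈′ c) (wkT-sub0 c a) (wkT-sub0 c b)
    (∀E (⇒E (∧E₁ (≐-unfold a b)) e) c)

IsClassOf : ∀ {Δ} → Tm Δ κ → Fm (ι ∷ Δ) → Fm Δ
IsClassOf c B = ∀ᶠ ι (v₀ ∈′ wkT c ⇔ᶠ B)

∈-class : ∀ {Δ} {H : List (Fm Δ)} {c B} → H ⊢ᶜ IsClassOf c B → (t : Tm Δ ι) → H ⊢ᶜ t ∈′ c ⇔ᶠ B [ t ]₀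
∈-class {c = c} {B} p t = subst (λ u → _ ⊢ᶜ t ∈′ u ⇔ᶠ B [ t ]₀) (wkT-sub0 t c) (∀E p t)

class-⊆ : ∀ {Δ} {H : List (Fm Δ)} {c B} → H ⊢ᶜ IsClassOf c B → H ⊢ᶜ ∀ᶠ ι (v₀ ∈′ wkT c ⇒ᶠ B)
class-⊆ p = ∀I (∧E₁ (∀E-var p))

IsClassOf-wk : ∀ {Δ} {H : List (Fm Δ)} {c B} → H ⊢ᶜ IsClassOf c B →
               map wkF H ⊢ᶜ IsClassOf (wkT {t = ι} c) (renF (liftR there) B)
IsClassOf-wk {c = c} {B} p =
  subst (λ u → _ ⊢ᶜ ∀ᶠ ι (v₀ ∈′ u ⇔ᶠ renF (liftR there) B)) (wkT-wkT c) (wkPf p)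

class-subst : ∀ {Δ} {H : List (Fm Δ)} {c B} {a b : Tm Δ ι} → H ⊢ᶜ IsClassOf c B →
              H ⊢ᶜ a ≐ b → H ⊢ᶜ B [ a ]₀ → H ⊢ᶜ B [ b ]₀
class-subst {c = c} {a = a} {b} cls e Ba =
  ⇒E (∧E₁ (∈-class cls b)) (⇒E (≐-elim e c) (⇒E (∧E₂ (∈-class cls a)) Ba))

HasClasses : List ⊤ → Set
HasClasses Γ = (P : N.Fm (tt ∷ Γ)) → Σ[ c ∈ Tm (map toι Γ) κ ] [] ⊢ᶜ IsClassOf c (embF P)

-- The comprehension axioms only provide classes in contexts of the form replicate n tt.
replicate-length : (Γ : List ⊤) → replicate (length Γ) tt ≡ Γ
replicate-length []       = refl
replicate-length (_ ∷ Γ)  = cong (tt ∷_) (replicate-length Γ)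

comprehension : (Γ : List ⊤) → HasClasses Γ
comprehension Γ = subst HasClasses (replicate-length Γ) (comprehension-replicate (length Γ))
  where
  comprehension-replicate : (n : ℕ) → HasClasses (replicate n tt)
  comprehension-replicate n P =
    app (comp n P) (idArgs _) , closeAll-elim (map toι (replicate n tt)) (axiom (comp-ax n P))

≐-subst : (Γ : List ⊤) (P : N.Fm (tt ∷ Γ)) {H : List (Fm (map toι Γ))} {a b : Tm (map toι Γ) ι} →
          H ⊢ᶜ a ≐ b → H ⊢ᶜ embF P [ a ]₀ → H ⊢ᶜ embF P [ b ]₀
≐-subst Γ P = class-subst (weakenHyps (λ ()) (proj₂ (comprehension Γ P)))

SuccClosed : ∀ {Δ} → Tm Δ κ → Fm Δ
SuccClosed c = ∀ᶠ ι (Nat′ v₀ ⇒ᶠ v₀ ∈′ wkT c ⇒ᶠ S′ v₀ ∈′ wkT c)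

Nat-intro : ∀ {Δ} {H : List (Fm Δ)} {t : Tm Δ ι} →
            H ⊢ᶜ ∀ᶠ κ (𝟎 ∈′ v₀ ⇒ᶠ SuccClosed v₀ ⇒ᶠ wkT t ∈′ v₀) → H ⊢ᶜ Nat′ t
Nat-intro {t = t} p = ⇒E (∧E₂ (∀E (ax nat-def) t)) p

Nat-elim : ∀ {Δ} {H : List (Fm Δ)} {t : Tm Δ ι} → H ⊢ᶜ Nat′ t → (c : Tm Δ κ) →
           H ⊢ᶜ 𝟎 ∈′ c → H ⊢ᶜ SuccClosed c → H ⊢ᶜ t ∈′ c
Nat-elim {H = H} {t} n c z s = ⇒E (⇒E elim z) s
  where
  elim : H ⊢ᶜ 𝟎 ∈′ c ⇒ᶠ SuccClosed c ⇒ᶠ t ∈′ c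
  elim = subst (λ u → _ ⊢ᶜ 𝟎 ∈′ c ⇒ᶠ SuccClosed c ⇒ᶠ u ∈′ c) (wkT-sub0 c t)
           (∀E (⇒E (∧E₁ (∀E (ax nat-def) t)) n) c)

Nat-induction : ∀ {Δ} {H : List (Fm Δ)} {c : Tm Δ κ} →
                H ⊢ᶜ 𝟎 ∈′ c → H ⊢ᶜ SuccClosed c → H ⊢ᶜ ∀ᶠ ι (Nat′ v₀ ⇒ᶠ v₀ ∈′ wkT c)
Nat-induction {H = H} {c} z s =
  ∀I (⇒I (Nat-elim hyp₀ (wkT c) (weakenHyps thereᴸ (wkPf z)) (weakenHyps thereᴸ s↑)))
  where
  s↑ : map wkF H ⊢ᶜ SuccClosed (wkT c)
  s↑ = subst (λ u → _ ⊢ᶜ ∀ᶠ ι (Nat′ v₀ ⇒ᶠ v₀ ∈′ u ⇒ᶠ S′ v₀ ∈′ u)) (wkT-wkT c) (wkPf s)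

-- The successor case reads B(S y) as the weakening of B under its binder, instantiated at S v₀.
class-induction : ∀ {Δ} {H : List (Fm Δ)} {c : Tm Δ κ} {B : Fm (ι ∷ Δ)} → [] ⊢ᶜ IsClassOf c B →
                  H ⊢ᶜ B [ 𝟎 ]₀
                       ⇒ᶠ ∀ᶠ ι (Nat′ v₀ ⇒ᶠ B ⇒ᶠ renF (liftR there) B [ S′ v₀ ]₀)
                       ⇒ᶠ ∀ᶠ ι (Nat′ v₀ ⇒ᶠ B)
class-induction {H = H} {c} {B} cls =
  ⇒I (⇒I (∀-⇒-trans (Nat-induction zero∈c succClosed) (class-⊆ cls′)))
  where
  B⁺ : Fm (ι ∷ _)
  B⁺ = renF (liftR there) B [ S′ v₀ ]₀

  H′ : List (Fm _)
  H′ = ∀ᶠ ι (Nat′ v₀ ⇒ᶠ B ⇒ᶠ B⁺) ∷ B [ 𝟎 ]₀ ∷ H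

  cls′ : ∀ {H} → H ⊢ᶜ IsClassOf c B
  cls′ = weakenHyps (λ ()) cls

  zero∈c : H′ ⊢ᶜ 𝟎 ∈′ c
  zero∈c = ⇒E (∧E₂ (∈-class cls′ 𝟎)) hyp₁

  succClosed : H′ ⊢ᶜ SuccClosed c
  succClosed = ∀I (⇒I (⇒I (⇒E (∧E₂ (∈-class cls↑ (S′ v₀))) (⇒E (⇒E step hyp₁) B-here))))
    where
    H″ : List (Fm (ι ∷ _))
    H″ = v₀ ∈′ wkT c ∷ Nat′ v₀ ∷ map wkF H′

    cls↑ : H″ ⊢ᶜ IsClassOf (wkT c) (renF (liftR there) B)
    cls↑ = weakenHyps (λ ()) (IsClassOf-wk cls)

    step : H″ ⊢ᶜ Nat′ v₀ ⇒ᶠ B ⇒ᶠ B⁺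
    step = weakenHyps (λ m → thereᴸ (thereᴸ m)) (∀E-var hyp₀)

    B-here : H″ ⊢ᶜ B
    B-here = ⇒E (weakenHyps (λ m → thereᴸ (thereᴸ m)) (∀E-var (class-⊆ cls′))) hyp₀

Ind-provable : (Γ : List ⊤) (P : N.Fm (tt ∷ Γ)) → [] ⊢ᶜ embF (N.Ind P)
Ind-provable Γ P =
  subst₂ (λ Z S → [] ⊢ᶜ Z ⇒ᶠ ∀ᶠ ι (Nat′ v₀ ⇒ᶠ embF P ⇒ᶠ S) ⇒ᶠ ∀ᶠ ι (Nat′ v₀ ⇒ᶠ embF P))
    (sym (embF-sub0 P N.𝟎)) (sym (embF-substSucc P))
    (class-induction (proj₂ (comprehension Γ P)))

N-v4 : ∀ {Γ} → N.Tm (tt ∷ tt ∷ tt ∷ tt ∷ tt ∷ Γ) tt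
N-v4 = N.var (N.there (N.there (N.there (N.there N.here))))

-- Each equality axiom is ≐-subst into an HA_N predicate whose innermost variable
-- marks the position being rewritten; the other variables are shifted up by one.
axioms-provable : ∀ {A} → N.Axiom A → [] ⊢ᶜ embF A
axioms-provable N.eq-refl    = ∀I (≐-refl v₀)
axioms-provable N.eq-succ    =
  ∀I (∀I (⇒I (≐-subst (replicate 2 tt) (N.S′ N.v2 N.≐ N.S′ N.v0) hyp₀ (≐-refl _))))
axioms-provable N.eq-pred    =
  ∀I (∀I (⇒I (≐-subst (replicate 2 tt) (N.P′ N.v2 N.≐ N.P′ N.v0) hyp₀ (≐-refl _))))
axioms-provable N.eq-plus    = ∀I (∀I (∀I (∀I (⇒I (⇒I
  (≐-subst (replicate 4 tt) (N-v4 N.+′ N.v2 N.≐ N.v3 N.+′ N.v0) hyp₀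
    (≐-subst (replicate 4 tt) (N-v4 N.+′ N.v2 N.≐ N.v0 N.+′ N.v2) hyp₁ (≐-refl _))))))))
axioms-provable N.eq-times   = ∀I (∀I (∀I (∀I (⇒I (⇒I
  (≐-subst (replicate 4 tt) (N-v4 N.×′ N.v2 N.≐ N.v3 N.×′ N.v0) hyp₀
    (≐-subst (replicate 4 tt) (N-v4 N.×′ N.v2 N.≐ N.v0 N.×′ N.v2) hyp₁ (≐-refl _))))))))
axioms-provable N.eq-eq      = ∀I (∀I (∀I (∀I (⇒I (⇒I (⇒I
  (≐-subst (replicate 4 tt) (N.v3 N.≐ N.v0) hyp₁
    (≐-subst (replicate 4 tt) (N.v0 N.≐ N.v2) hyp₂ hyp₀))))))))
axioms-provable N.eq-null    =
  ∀I (∀I (⇒I (⇒I (≐-subst (replicate 2 tt) (N.Null′ N.v0) hyp₁ hyp₀))))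
axioms-provable N.eq-nat     =
  ∀I (∀I (⇒I (⇒I (≐-subst (replicate 2 tt) (N.Nat′ N.v0) hyp₁ hyp₀))))
axioms-provable (N.ind Γ P)  =
  castPf (sym (embF-closeAll Γ (N.Ind P))) (closeAll-intro (map toι Γ) (Ind-provable Γ P))
axioms-provable N.nat0       = Nat-intro (∀I (⇒I (⇒I hyp₁)))
axioms-provable N.natS       = ∀I (⇒I (Nat-intro (∀I (⇒I (⇒I
  (⇒E (⇒E (∀E hyp₀ v₁) hyp₂) (Nat-elim hyp₂ v₀ hyp₁ hyp₀)))))))
axioms-provable (N.arith a)  = axiom (arith a)

embPf : ∀ {Γ H A} → N.Pf N.Axiom Γ H A → map embF H ⊢ᶜ embF A
embPf (N.ax {A = A} a)                =
  castPf (sym (embF-renF N.emptyRen A)) (renPf (embRen N.emptyRen) (λ ()) (axioms-provable a))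
embPf (N.hyp m)                       = hyp (∈-map⁺ embF m)
embPf N.⊤I                            = ⊤I
embPf (N.⊥E p)                        = ⊥E (embPf p)
embPf (N.∧I p q)                      = ∧I (embPf p) (embPf q)
embPf (N.∧E₁ p)                       = ∧E₁ (embPf p)
embPf (N.∧E₂ p)                       = ∧E₂ (embPf p)
embPf (N.∨I₁ p)                       = ∨I₁ (embPf p)
embPf (N.∨I₂ p)                       = ∨I₂ (embPf p)
embPf (N.∨E p q r)                    = ∨E (embPf p) (embPf q) (embPf r)
embPf (N.⇒I p)                        = ⇒I (embPf p)
embPf (N.⇒E p q)                      = ⇒E (embPf p) (embPf q)
embPf (N.∀I {H = H} {A = A} p)        = ∀I (subst (_⊢ᶜ embF A) (map-embF-wkF H) (embPf p))
embPf (N.∀E {A = A} p t)              = castPf (sym (embF-sub0 A t)) (∀E (embPf p) (embT t))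
embPf (N.∃I {A = A} t p)              = ∃I (embT t) (castPf (embF-sub0 A t) (embPf p))
embPf (N.∃E {H = H} {A = A} {C} p q)  =
  ∃E (embPf p)
    (castPf (embF-wkF C) (subst (λ L → embF A ∷ L ⊢ᶜ embF (N.wkF C)) (map-embF-wkF H) (embPf q)))

proposition11 : (Γ : List ⊤) (A : HAN.Fm Γ) →
    HAN._⊢_ HAN.Axiom A → HAC._⊢_ HAC.Axiom (embF A)
proposition11 Γ A = embPf
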